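{- Let $m \in \mathbb{N}$, $n = 2^m$, and let $\mathcal{H} \subset \mathbb{R}^n$ be the Hadamard polytope. For every integer point $v \in \mathcal{H} \cap \mathbb{Z}^n$, the set $\mathrm{supp}(v)$ is a linear subspace of $\mathbb{F}_2^m$. Further, $T(v) = \mathrm{supp}(v)^{\perp} + b$ for some $b \in \mathbb{F}_2^m$, and $$v = \frac{1}{|T(v)|}\sum_{c \in T(v)} h_c,$$ i.e. $v$ is a uniform convex combination of the vertices $h_c$, $c \in T(v)$.
   Context: Let $n = 2^m$. The $n \times n$ Hadamard matrix $H$ has rows and columns indexed by elements of $\mathbb{F}_2^m$, with $H(a,b) = (-1)^{\langle a,b\rangle}$, where $\langle a,b\rangle$ is the standard dot product on $\mathbb{F}_2^m$. For $a \in \mathbb{F}_2^m$, $h_a \in \mathbb{R}^n$ denotes the column of $H$ indexed by $a$. The Hadamard polytope $\mathcal{H}$ is the convex hull of $\{h_a : a \in \mathbb{F}_2^m\}$; these vectors are linearly independent, so $\mathcal{H}$ is an $(n-1)$-dimensional simplex with these as vertices. The coordinates of $\mathbb{R}^n$ are identified with vectors of $\mathbb{F}_2^m$ (the same indexing as the rows of $H$, with the first coordinate corresponding to the zero vector); for $v \in \mathbb{R}^n$ and $a \in \mathbb{F}_2^m$, $v(a)$ is the $a$-th coordinate of $v$, and $\mathrm{supp}(v) = \{a \in \mathbb{F}_2^m : v(a) \neq 0\}$. Every $v \in \mathcal{H}$ has a unique expression $v = \sum_{a} t_a h_a$ with $t_a \ge 0$, $\sum_a t_a = 1$; define $T(v)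 = \{a \in \mathbb{F}_2^m : t_a \neq 0\}$. For a subspace $V \subseteq \mathbb{F}_2^m$, $V^{\perp} = \{c : \langle a,c\rangle = 0 \text{ for all } a \in V\}$.
   Formalization: The coefficients $t_a$ in the expression $v = \sum_{a} t_a h_a$ are taken rational rather than real. -}

module Defs where

open import Data.Bool using (Bool; true; false; _∧_; _xor_)
open import Data.Nat using (ℕ; zero; suc)
open import Data.Integer using (ℤ; +_)
open import Data.Rational using (ℚ; 0ℚ; 1ℚ; _+_; _*_; -_; _≤_; _/_)
open import Data.Rational.Properties using (_≟_)
open import Data.Vec using (Vec; []; _∷_; zipWith; replicate)
open import Data.List using (List; map; _++_; foldr; filter; length) renaming ([_] to [_]ˡ)
open import Data.Product using (_×_; Σ-syntax)
open import Relation.Binary.PropositionalEquality using (_≡_)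
open import Relation.Nullary using (¬_)
open import Relation.Nullary.Decidable using (¬?)

F2 : ℕ → Set
F2 m = Vec Bool m

_⊕_ : {m : ℕ} → F2 m → F2 m → F2 m
_⊕_ = zipWith _xor_

𝟘 : (m : ℕ) → F2 m
𝟘 m = replicate m false

dot : {m : ℕ} → F2 m → F2 m → Bool
dot [] [] = false
dot (x ∷ xs) (y ∷ ys) = (x ∧ y) xor dot xs ys

allVecs : (m : ℕ) → List (F2 m)
allVecs zero = [ [] ]ˡ
allVecs (suc m) = map (false ∷_) (allVecs m) ++ map (true ∷_) (allVecs m)

sumℚ : List ℚ → ℚ
sumℚ = foldr _+_ 0ℚ

ΣF2 : (m : ℕ) → (F2 m → ℚ) → ℚ
ΣF2 m f = sumℚ (map f (allVecs m))

sgn : Bool → ℚ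
sgn false = 1ℚ
sgn true = - 1ℚ

-- h_a : column a of the Hadamard matrix; its x-th coordinate is H(x,a)
h : {m : ℕ} → F2 m → F2 m → ℚ
h a x = sgn (dot x a)

toℚ : ℤ → ℚ
toℚ z = z / 1

-- v (an integer point) equals the convex combination Σ_a t_a h_a,
-- i.e. v ∈ 𝓗 with barycentric coordinates t
InHadamard : (m : ℕ) → (F2 m → ℤ) → (F2 m → ℚ) → Set
InHadamard m v t =
  (∀ a → 0ℚ ≤ t a) × (ΣF2 m t ≡ 1ℚ) × (∀ x → toℚ (v x) ≡ ΣF2 m (λ a → t a * h a x))

supp : {m : ℕ} → (F2 m → ℤ) → F2 m → Set
supp v a = ¬ (v a ≡ + 0)

IsSubspace : (m : ℕ) → (F2 m → Set) → Set
IsSubspace m S = S (𝟘 m) × (∀ x y → S x → S y → S (x ⊕ y))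

Perp : (m : ℕ) → (F2 m → Set) → F2 m → Set
Perp m V c = ∀ a → V a → dot a c ≡ false

Tset : {m : ℕ} → (F2 m → ℚ) → F2 m → Set
Tset t a = ¬ (t a ≡ 0ℚ)

Tlist : (m : ℕ) → (F2 m → ℚ) → List (F2 m)
Tlist m t = filter (λ a → ¬? (t a ≟ 0ℚ)) (allVecs m)

cardT : (m : ℕ) → (F2 m → ℚ) → ℚ
cardT m t = (+ length (Tlist m t)) / 1

sumHT : (m : ℕ) → (F2 m → ℚ) → F2 m → ℚ
sumHT m t x = sumℚ (map (λ c → h c x) (Tlist m t))

{-# OPTIONS --safe #-}
module Submission where

-- Since v(x) = Σ_a t_a h_a(x) is a convex combination of signs, an integer coordinate
-- v(x) is 0 or ±1, and it is ±1 exactly when a ↦ ⟨x,a⟩ is constant on T(v); this makes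
-- supp(v) closed under addition. Inverting the Hadamard transform, n t_a = Σ_x v(x) h_a(x),
-- and h_{c+a} agrees with h_a on supp(v) when c ∈ supp(v)^⊥, so t is constant on the
-- cosets of supp(v)^⊥. As ⟨x,a⟩ is constant on T(v) for every x ∈ supp(v), the set T(v)
-- lies in one such coset, hence is all of it, and carries equal weights.

open import Defs
open import Algebra.Bundles using (CommutativeMonoid; CommutativeRing)
import Algebra.Properties.CommutativeSemigroup as CommutativeSemigroupProperties
open import Data.Bool using (Bool; true; false; _∧_; _xor_; not)
open import Data.Bool.Properties
  using (xor-assoc; xor-same; xor-identityʳ; ∧-distribˡ-xor; ∧-distribʳ-xor; xor-∧-commutativeRing)
open import Data.Empty using (⊥-elim)
open import Data.Integer as ℤ using (ℤ; -[1+_]) renaming (+_ to pos)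
import Data.Integer.Properties as ℤ
open import Data.List using (List; []; _∷_; map; _++_; filter; length)
import Data.List.Properties as List
open import Data.List.Membership.Propositional using (_∈_)
open import Data.List.Membership.Propositional.Properties using (∈-map⁺; ∈-++⁺ˡ; ∈-++⁺ʳ)
open import Data.List.Relation.Unary.Any using (here; there)
open import Data.Nat as ℕ using (ℕ; zero; suc)
import Data.Nat.Coprimality as Coprimality
open import Data.Product using (_×_; _,_; ∃; Σ-syntax; proj₁; proj₂)
open import Data.Rational using (ℚ; 0ℚ; 1ℚ; _+_; _*_; -_; _≤_; _<_; _/_; mkℚ; *<*; positive)
open import Data.Rational.Properties
  using ( _≟_; normalize-coprime; positive⁻¹; nonNegative⁻¹
        ; +-identityˡ; +-identityʳ; +-assoc; +-inverseʳ; neg-distrib-+; neg-distribʳ-*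
        ; *-identityʳ; *-zeroˡ; *-zeroʳ; *-comm; *-assoc; *-distribˡ-+; +-0-commutativeMonoid
        ; ≤-refl; ≤-reflexive; ≤-trans; ≤-antisym; <-irrefl; <-≤-trans
        ; +-mono-≤; +-monoʳ-≤; neg-antimono-≤; *-cancelʳ-≤-pos; module ≤-Reasoning )
open import Data.Vec using ([]; _∷_)
open import Data.Vec.Properties using (∷-injectiveʳ)
open import Function using (_∘_)
open import Relation.Binary.PropositionalEquality
open import Relation.Nullary using (yes; no)
open import Relation.Nullary.Decidable using (¬?)

open CommutativeSemigroupProperties
  (CommutativeRing.+-commutativeSemigroup xor-∧-commutativeRing)
  using () renaming (interchange to xor-interchange)
open CommutativeSemigroupProperties
  (CommutativeMonoid.commutativeSemigroup +-0-commutativeMonoid)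
  using () renaming (interchange to +-interchange)

xor-cancelʳ : ∀ x y → (x xor y) xor y ≡ x
xor-cancelʳ x y = trans (xor-assoc x y y) (trans (cong (x xor_) (xor-same y)) (xor-identityʳ x))

xor-not≡true⇒≡ : ∀ {x y} → x xor not y ≡ true → x ≡ y
xor-not≡true⇒≡ {false} {false} _ = refl
xor-not≡true⇒≡ {true}  {true}  _ = refl

⊕-identityˡ : ∀ {m} (a : F2 m) → 𝟘 m ⊕ a ≡ a
⊕-identityˡ []       = refl
⊕-identityˡ (a ∷ as) = cong (a ∷_) (⊕-identityˡ as)

⊕-cancelʳ : ∀ {m} (a b : F2 m) → (a ⊕ b) ⊕ b ≡ a
⊕-cancelʳ []       []       = refl
⊕-cancelʳ (a ∷ as) (b ∷ bs) = cong₂ _∷_ (xor-cancelʳ a b) (⊕-cancelʳ as bs)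

⊕≡𝟘⇒≡ : ∀ {m} {a c : F2 m} → a ⊕ c ≡ 𝟘 m → a ≡ c
⊕≡𝟘⇒≡ {a = a} {c} a⊕c≡𝟘 =
  trans (sym (⊕-cancelʳ a c)) (trans (cong (_⊕ c) a⊕c≡𝟘) (⊕-identityˡ c))

dot-𝟘ˡ : ∀ {m} (a : F2 m) → dot (𝟘 m) a ≡ false
dot-𝟘ˡ []       = refl
dot-𝟘ˡ (a ∷ as) = dot-𝟘ˡ as

dot-⊕ʳ : ∀ {m} (x a b : F2 m) → dot x (a ⊕ b) ≡ dot x a xor dot x b
dot-⊕ʳ []       []       []       = refl
dot-⊕ʳ (x ∷ xs) (a ∷ as) (b ∷ bs) =
  trans (cong₂ _xor_ (∧-distribˡ-xor x a b) (dot-⊕ʳ xs as bs))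
        (xor-interchange (x ∧ a) (x ∧ b) (dot xs as) (dot xs bs))

dot-⊕ˡ : ∀ {m} (x y a : F2 m) → dot (x ⊕ y) a ≡ dot x a xor dot y a
dot-⊕ˡ []       []       []       = refl
dot-⊕ˡ (x ∷ xs) (y ∷ ys) (a ∷ as) =
  trans (cong₂ _xor_ (∧-distribʳ-xor a x y) (dot-⊕ˡ xs ys as))
        (xor-interchange (x ∧ a) (y ∧ a) (dot xs as) (dot ys as))

dot-⊕-perp : ∀ {m} {S : F2 m → Set} {c x : F2 m} → Perp m S c → S x →
             ∀ b → dot x (c ⊕ b) ≡ dot x b
dot-⊕-perp {c = c} {x} c⊥S x∈S b = trans (dot-⊕ʳ x c b) (cong (_xor dot x b) (c⊥S x x∈S))

sgn-xor : ∀ p q → sgn (p xor q) ≡ sgn p * sgn q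
sgn-xor false false = refl
sgn-xor false true  = refl
sgn-xor true  false = refl
sgn-xor true  true  = refl

sgn-sq : ∀ p → sgn p * sgn p ≡ 1ℚ
sgn-sq false = refl
sgn-sq true  = refl

sgn-*-not : ∀ p → sgn p * sgn (not p) ≡ - 1ℚ
sgn-*-not false = refl
sgn-*-not true  = refl

sgn≢0 : ∀ p → sgn p ≢ 0ℚ
sgn≢0 false ()
sgn≢0 true  ()

*-sgn-true : ∀ q → q * sgn true ≡ - q
*-sgn-true q = trans (sym (neg-distribʳ-* q 1ℚ)) (cong -_ (*-identityʳ q))

-q≤q : ∀ {q} → 0ℚ ≤ q → - q ≤ q
-q≤q 0≤q = ≤-trans (neg-antimono-≤ 0≤q) 0≤q

*-sgn≤ : ∀ p {q} → 0ℚ ≤ q → q * sgn p ≤ q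
*-sgn≤ false {q} _   = ≤-reflexive (*-identityʳ q)
*-sgn≤ true  {q} 0≤q = subst (_≤ q) (sym (*-sgn-true q)) (-q≤q 0≤q)

-≤*-sgn : ∀ p {q} → 0ℚ ≤ q → - q ≤ q * sgn p
-≤*-sgn false {q} 0≤q = subst (- q ≤_) (sym (*-identityʳ q)) (-q≤q 0≤q)
-≤*-sgn true  {q} _   = ≤-reflexive (sym (*-sgn-true q))

0≤+*-sgn : ∀ p {q} → 0ℚ ≤ q → 0ℚ ≤ q + q * sgn p
0≤+*-sgn p {q} 0≤q = subst (_≤ q + q * sgn p) (+-inverseʳ q) (+-monoʳ-≤ q (-≤*-sgn p 0≤q))

p≤p+q : ∀ {p q} → 0ℚ ≤ q → p ≤ p + q
p≤p+q {p} {q} 0≤q = subst (_≤ p + q) (+-identityʳ p) (+-monoʳ-≤ p 0≤q)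

*-cancelʳ-≡-pos : ∀ {p q} r → 0ℚ < r → p * r ≡ q * r → p ≡ q
*-cancelʳ-≡-pos r 0<r pr≡qr =
  ≤-antisym (*-cancelʳ-≤-pos r (≤-reflexive pr≡qr)) (*-cancelʳ-≤-pos r (≤-reflexive (sym pr≡qr)))
  where instance _ = positive 0<r

-- toℚ (pos n) = normalize n 1 does not reduce for a variable n, since it divides by a gcd.
toℚ-pos : ∀ n → toℚ (pos n) ≡ mkℚ (pos n) 0 (Coprimality.sym (Coprimality.1-coprimeTo n))
toℚ-pos n = normalize-coprime (Coprimality.sym (Coprimality.1-coprimeTo n))

1+toℚ-pos : ∀ n → 1ℚ + toℚ (pos n) ≡ toℚ (pos (suc n))
1+toℚ-pos n = trans (cong (1ℚ +_) (toℚ-pos n)) (cong (λ z → (pos 1 ℤ.+ z) / 1) (ℤ.*-identityʳ (pos n)))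

integer-in-[-1,1] : ∀ z → - 1ℚ ≤ toℚ z → toℚ z ≤ 1ℚ → z ≢ pos 0 → ∃ λ β → toℚ z ≡ sgn β
integer-in-[-1,1] (pos zero)          _    _   z≢0 = ⊥-elim (z≢0 refl)
integer-in-[-1,1] (pos (suc zero))    _    _   _   = false , refl
integer-in-[-1,1] (pos (suc (suc n))) _    z≤1 _   = ⊥-elim (<-irrefl refl (<-≤-trans 1<z z≤1))
  where
  1<z : 1ℚ < toℚ (pos (suc (suc n)))
  1<z = subst (1ℚ <_) (sym (toℚ-pos (suc (suc n)))) (*<* (ℤ.+<+ (ℕ.s≤s (ℕ.s≤s ℕ.z≤n))))
integer-in-[-1,1] -[1+ zero ]         _    _   _   = true , refl
integer-in-[-1,1] -[1+ suc n ]        -1≤z _   _   = ⊥-elim (<-irrefl refl (<-≤-trans z<-1 -1≤z))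
  where
  z<-1 : toℚ -[1+ suc n ] < - 1ℚ
  z<-1 = subst (_< - 1ℚ) (sym (cong -_ (toℚ-pos (suc (suc n))))) (*<* (ℤ.-<- (ℕ.s≤s ℕ.z≤n)))

sumℚ-++ : (ps qs : List ℚ) → sumℚ (ps ++ qs) ≡ sumℚ ps + sumℚ qs
sumℚ-++ []       qs = sym (+-identityˡ (sumℚ qs))
sumℚ-++ (p ∷ ps) qs = trans (cong (p +_) (sumℚ-++ ps qs)) (sym (+-assoc p _ _))

private variable A B : Set

sumℚ-map-cong : ∀ {f g : A → ℚ} → (∀ x → f x ≡ g x) → ∀ xs → sumℚ (map f xs) ≡ sumℚ (map g xs)
sumℚ-map-cong f≗g xs = cong sumℚ (List.map-cong f≗g xs)

sumℚ-map-zero : ∀ {f : A → ℚ} → (∀ x → f x ≡ 0ℚ) → ∀ xs → sumℚ (map f xs) ≡ 0ℚ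
sumℚ-map-zero f≗0 []       = refl
sumℚ-map-zero f≗0 (x ∷ xs) = cong₂ _+_ (f≗0 x) (sumℚ-map-zero f≗0 xs)

sumℚ-map-+ : ∀ (f g : A → ℚ) xs →
             sumℚ (map (λ x → f x + g x) xs) ≡ sumℚ (map f xs) + sumℚ (map g xs)
sumℚ-map-+ f g []       = refl
sumℚ-map-+ f g (x ∷ xs) = trans (cong (f x + g x +_) (sumℚ-map-+ f g xs))
                                (+-interchange (f x) (g x) _ _)

sumℚ-map-neg : ∀ (f : A → ℚ) xs → sumℚ (map (λ x → - f x) xs) ≡ - sumℚ (map f xs)
sumℚ-map-neg f []       = refl
sumℚ-map-neg f (x ∷ xs) =
  trans (cong (- f x +_) (sumℚ-map-neg f xs)) (sym (neg-distrib-+ (f x) _))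

sumℚ-map-*ˡ : ∀ k (f : A → ℚ) xs → sumℚ (map (λ x → k * f x) xs) ≡ k * sumℚ (map f xs)
sumℚ-map-*ˡ k f []       = sym (*-zeroʳ k)
sumℚ-map-*ˡ k f (x ∷ xs) =
  trans (cong (k * f x +_) (sumℚ-map-*ˡ k f xs)) (sym (*-distribˡ-+ k (f x) _))

sumℚ-map-*ʳ : ∀ k (f : A → ℚ) xs → sumℚ (map (λ x → f x * k) xs) ≡ sumℚ (map f xs) * k
sumℚ-map-*ʳ k f xs = trans (sumℚ-map-cong (λ x → *-comm (f x) k) xs)
                           (trans (sumℚ-map-*ˡ k f xs) (*-comm k _))

sumℚ-map-swap : ∀ (g : A → B → ℚ) xs ys →
                sumℚ (map (λ x → sumℚ (map (g x) ys)) xs)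
                ≡ sumℚ (map (λ y → sumℚ (map (λ x → g x y) xs)) ys)
sumℚ-map-swap g []       ys = sym (sumℚ-map-zero (λ _ → refl) ys)
sumℚ-map-swap g (x ∷ xs) ys =
  trans (cong (sumℚ (map (g x) ys) +_) (sumℚ-map-swap g xs ys))
        (sym (sumℚ-map-+ (g x) (λ y → sumℚ (map (λ x′ → g x′ y) xs)) ys))

sumℚ-map-mono-≤ : ∀ {f g : A → ℚ} → (∀ x → f x ≤ g x) → ∀ xs →
                  sumℚ (map f xs) ≤ sumℚ (map g xs)
sumℚ-map-mono-≤ f≤g []       = ≤-refl
sumℚ-map-mono-≤ f≤g (x ∷ xs) = +-mono-≤ (f≤g x) (sumℚ-map-mono-≤ f≤g xs)

sumℚ-map-nonneg : ∀ {f : A → ℚ} → (∀ x → 0ℚ ≤ f x) → ∀ xs → 0ℚ ≤ sumℚ (map f xs)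
sumℚ-map-nonneg {f = f} 0≤f xs =
  subst (_≤ sumℚ (map f xs)) (sumℚ-map-zero (λ _ → refl) xs) (sumℚ-map-mono-≤ 0≤f xs)

sumℚ-map-∈-≤ : ∀ {f : A → ℚ} → (∀ x → 0ℚ ≤ f x) → ∀ {x xs} → x ∈ xs → f x ≤ sumℚ (map f xs)
sumℚ-map-∈-≤ 0≤f {xs = _ ∷ xs} (here refl) = p≤p+q (sumℚ-map-nonneg 0≤f xs)
sumℚ-map-∈-≤ {f = f} 0≤f {xs = y ∷ ys} (there x∈ys) =
  ≤-trans (sumℚ-map-∈-≤ 0≤f x∈ys) (subst (_≤ f y + sumℚ (map f ys))
    (+-identityˡ (sumℚ (map f ys))) (+-mono-≤ (0≤f y) ≤-refl))

sumℚ-map-≢0 : ∀ (f : A → ℚ) xs → sumℚ (map f xs) ≢ 0ℚ → ∃ λ x → f x ≢ 0ℚ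
sumℚ-map-≢0 f []       Σ≢0 = ⊥-elim (Σ≢0 refl)
sumℚ-map-≢0 f (x ∷ xs) Σ≢0 with f x ≟ 0ℚ
... | no  fx≢0 = x , fx≢0
... | yes fx≡0 = sumℚ-map-≢0 f xs (λ Σ≡0 → Σ≢0 (trans (cong₂ _+_ fx≡0 Σ≡0) refl))

sumℚ-map-1 : ∀ (xs : List A) → sumℚ (map (λ _ → 1ℚ) xs) ≡ pos (length xs) / 1
sumℚ-map-1 []       = refl
sumℚ-map-1 (x ∷ xs) = trans (cong (1ℚ +_) (sumℚ-map-1 xs)) (1+toℚ-pos (length xs))

sumℚ-map-uniform : ∀ (t g : A → ℚ) {τ} → (∀ x → t x ≢ 0ℚ → t x ≡ τ) → ∀ xs →
                   sumℚ (map (λ x → t x * g x) xs)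
                   ≡ τ * sumℚ (map g (filter (λ x → ¬? (t x ≟ 0ℚ)) xs))
sumℚ-map-uniform t g {τ} t≡τ []       = sym (*-zeroʳ τ)
sumℚ-map-uniform t g {τ} t≡τ (x ∷ xs) with t x ≟ 0ℚ
... | yes tx≡0 = trans (cong₂ _+_ (trans (cong (_* g x) tx≡0) (*-zeroˡ (g x)))
                                  (sumℚ-map-uniform t g t≡τ xs))
                       (+-identityˡ _)
... | no  tx≢0 = trans (cong₂ _+_ (cong (_* g x) (t≡τ x tx≢0)) (sumℚ-map-uniform t g t≡τ xs))
                       (sym (*-distribˡ-+ τ (g x) _))

∈-allVecs : ∀ {m} (a : F2 m) → a ∈ allVecs m
∈-allVecs []          = here refl
∈-allVecs (false ∷ a) = ∈-++⁺ˡ (∈-map⁺ (false ∷_) (∈-allVecs a))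
∈-allVecs (true ∷ a)  = ∈-++⁺ʳ (map (false ∷_) (allVecs _)) (∈-map⁺ (true ∷_) (∈-allVecs a))

ΣF2-suc : ∀ {m} (f : F2 (suc m) → ℚ) →
          ΣF2 (suc m) f ≡ ΣF2 m (λ a → f (false ∷ a)) + ΣF2 m (λ a → f (true ∷ a))
ΣF2-suc {m} f = trans (cong sumℚ (List.map-++ f (map (false ∷_) (allVecs m)) _))
  (trans (sumℚ-++ (map f (map (false ∷_) (allVecs m))) _)
         (sym (cong₂ _+_ (cong sumℚ (List.map-∘ (allVecs m))) (cong sumℚ (List.map-∘ (allVecs m))))))

ΣF2-delta : ∀ {m} {f : F2 m → ℚ} c → (∀ a → a ≢ c → f a ≡ 0ℚ) → ΣF2 m f ≡ f c
ΣF2-delta {zero}  {f} []          _     = +-identityʳ (f [])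
ΣF2-delta {suc m} {f} (false ∷ c) f≡0 = trans (ΣF2-suc f) (trans
  (cong₂ _+_ (ΣF2-delta c (λ a a≢c → f≡0 _ (a≢c ∘ ∷-injectiveʳ)))
             (sumℚ-map-zero (λ a → f≡0 (true ∷ a) λ ()) (allVecs m)))
  (+-identityʳ _))
ΣF2-delta {suc m} {f} (true ∷ c)  f≡0 = trans (ΣF2-suc f) (trans
  (cong₂ _+_ (sumℚ-map-zero (λ a → f≡0 (false ∷ a) λ ()) (allVecs m))
             (ΣF2-delta c (λ a a≢c → f≡0 _ (a≢c ∘ ∷-injectiveʳ))))
  (+-identityˡ _))

cardF2 : ℕ → ℚ
cardF2 m = ΣF2 m (λ _ → 1ℚ)

cardF2-pos : ∀ m → 0ℚ < cardF2 m
cardF2-pos m = <-≤-trans (positive⁻¹ 1ℚ)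
  (sumℚ-map-∈-≤ (λ _ → nonNegative⁻¹ 1ℚ) (∈-allVecs (𝟘 m)))

h-⊕ : ∀ {m} (a c x : F2 m) → h (a ⊕ c) x ≡ h a x * h c x
h-⊕ a c x = trans (cong sgn (dot-⊕ʳ x a c)) (sgn-xor (dot x a) (dot x c))

ΣF2-h-∷ : ∀ {m} d (ds : F2 m) → ΣF2 (suc m) (h (d ∷ ds)) ≡ ΣF2 m (h ds) + ΣF2 m (h ds) * sgn d
ΣF2-h-∷ {m} d ds = trans (ΣF2-suc (h (d ∷ ds))) (cong (ΣF2 m (h ds) +_)
  (trans (sumℚ-map-cong (λ x → trans (sgn-xor d (dot x ds)) (*-comm (sgn d) _)) (allVecs m))
         (sumℚ-map-*ʳ (sgn d) (h ds) (allVecs m))))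

ΣF2-h : ∀ {m} (d : F2 m) → d ≢ 𝟘 m → ΣF2 m (h d) ≡ 0ℚ
ΣF2-h []          d≢𝟘 = ⊥-elim (d≢𝟘 refl)
ΣF2-h {suc m} (true ∷ ds) _ = trans (ΣF2-h-∷ true ds)
  (trans (cong (ΣF2 m (h ds) +_) (*-sgn-true (ΣF2 m (h ds)))) (+-inverseʳ (ΣF2 m (h ds))))
ΣF2-h {suc m} (false ∷ ds) d≢𝟘 = trans (ΣF2-h-∷ false ds)
  (trans (cong (ΣF2 m (h ds) +_) (*-identityʳ (ΣF2 m (h ds)))) (cong₂ _+_ Σh≡0 Σh≡0))
  where
  Σh≡0 : ΣF2 m (h ds) ≡ 0ℚ
  Σh≡0 = ΣF2-h ds (d≢𝟘 ∘ cong (false ∷_))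

h-orthogonal : ∀ {m} {a c : F2 m} → a ≢ c → ΣF2 m (λ x → h a x * h c x) ≡ 0ℚ
h-orthogonal {m} {a} {c} a≢c =
  trans (sumℚ-map-cong (λ x → sym (h-⊕ a c x)) (allVecs m)) (ΣF2-h (a ⊕ c) (a≢c ∘ ⊕≡𝟘⇒≡))

h-norm : ∀ {m} (a : F2 m) → ΣF2 m (λ x → h a x * h a x) ≡ cardF2 m
h-norm {m} a = sumℚ-map-cong (λ x → sgn-sq (dot x a)) (allVecs m)

hadamard-inversion : ∀ m (t : F2 m → ℚ) c →
  ΣF2 m (λ x → ΣF2 m (λ a → t a * h a x) * h c x) ≡ t c * cardF2 m
hadamard-inversion m t c = begin
  ΣF2 m (λ x → ΣF2 m (λ a → t a * h a x) * h c x)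
    ≡⟨ sumℚ-map-cong (λ x → sym (sumℚ-map-*ʳ (h c x) (λ a → t a * h a x) (allVecs m))) (allVecs m) ⟩
  ΣF2 m (λ x → ΣF2 m (λ a → t a * h a x * h c x))
    ≡⟨ sumℚ-map-swap (λ x a → t a * h a x * h c x) (allVecs m) (allVecs m) ⟩
  ΣF2 m (λ a → ΣF2 m (λ x → t a * h a x * h c x))
    ≡⟨ sumℚ-map-cong (λ a → trans (sumℚ-map-cong (λ x → *-assoc (t a) (h a x) (h c x)) (allVecs m))
                                  (sumℚ-map-*ˡ (t a) (λ x → h a x * h c x) (allVecs m))) (allVecs m) ⟩
  ΣF2 m (λ a → t a * ΣF2 m (λ x → h a x * h c x))
    ≡⟨ ΣF2-delta c (λ a a≢c → trans (cong (t a *_) (h-orthogonal a≢c)) (*-zeroʳ (t a))) ⟩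
  t c * ΣF2 m (λ x → h c x * h c x)
    ≡⟨ cong (t c *_) (h-norm c) ⟩
  t c * cardF2 m ∎
  where open ≡-Reasoning

module SignCombination {m : ℕ} (t : F2 m → ℚ) (t≥0 : ∀ a → 0ℚ ≤ t a) (Σt≡1 : ΣF2 m t ≡ 1ℚ) where

  combination : (F2 m → Bool) → ℚ
  combination σ = ΣF2 m (λ a → t a * sgn (σ a))

  combination≤1 : ∀ σ → combination σ ≤ 1ℚ
  combination≤1 σ = subst (combination σ ≤_) Σt≡1
    (sumℚ-map-mono-≤ (λ a → *-sgn≤ (σ a) (t≥0 a)) (allVecs m))

  -1≤combination : ∀ σ → - 1ℚ ≤ combination σ
  -1≤combination σ = subst (_≤ combination σ) (trans (sumℚ-map-neg t (allVecs m)) (cong -_ Σt≡1))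
    (sumℚ-map-mono-≤ (λ a → -≤*-sgn (σ a) (t≥0 a)) (allVecs m))

  combination-const : ∀ {σ β} → (∀ a → t a ≢ 0ℚ → σ a ≡ β) → combination σ ≡ sgn β
  combination-const {σ} {β} σ≡β = begin
    combination σ               ≡⟨ sumℚ-map-cong termwise (allVecs m) ⟩
    ΣF2 m (λ a → sgn β * t a)   ≡⟨ sumℚ-map-*ˡ (sgn β) t (allVecs m) ⟩
    sgn β * ΣF2 m t             ≡⟨ cong (sgn β *_) Σt≡1 ⟩
    sgn β * 1ℚ                  ≡⟨ *-identityʳ (sgn β) ⟩
    sgn β                       ∎
    where
    open ≡-Reasoning
    termwise : ∀ a → t a * sgn (σ a) ≡ sgn β * t a
    termwise a with t a ≟ 0ℚ
    ... | yes ta≡0 rewrite ta≡0 = trans (*-zeroˡ (sgn (σ a))) (sym (*-zeroʳ (sgn β)))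
    ... | no  ta≢0 = trans (cong (λ b → t a * sgn b) (σ≡β a ta≢0)) (*-comm (t a) (sgn β))

  combination-xor : ∀ σ β → combination (λ a → σ a xor β) ≡ combination σ * sgn β
  combination-xor σ β = trans
    (sumℚ-map-cong (λ a → trans (cong (t a *_) (sgn-xor (σ a) β)) (sym (*-assoc (t a) _ _))) (allVecs m))
    (sumℚ-map-*ʳ (sgn β) (λ a → t a * sgn (σ a)) (allVecs m))

  combination≡-1⇒true : ∀ σ → combination σ ≡ - 1ℚ → ∀ a → t a ≢ 0ℚ → σ a ≡ true
  combination≡-1⇒true σ c≡-1 a ta≢0 with σ a in σa≡
  ... | true  = refl
  ... | false = ⊥-elim (ta≢0 (≤-antisym ta≤0 (t≥0 a)))
    where
    term : F2 m → ℚ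
    term b = t b + t b * sgn (σ b)

    ta≤0 : t a ≤ 0ℚ
    ta≤0 = begin
      t a                      ≤⟨ p≤p+q (subst (0ℚ ≤_) (sym (*-identityʳ (t a))) (t≥0 a)) ⟩
      t a + t a * sgn false    ≡⟨ cong (λ b → t a + t a * sgn b) (sym σa≡) ⟩
      term a                   ≤⟨ sumℚ-map-∈-≤ (λ b → 0≤+*-sgn (σ b) (t≥0 b)) (∈-allVecs a) ⟩
      ΣF2 m term               ≡⟨ sumℚ-map-+ t (λ b → t b * sgn (σ b)) (allVecs m) ⟩
      ΣF2 m t + combination σ  ≡⟨ cong₂ _+_ Σt≡1 c≡-1 ⟩
      1ℚ + - 1ℚ                ≡⟨ +-inverseʳ 1ℚ ⟩
      0ℚ                       ∎
      where open ≤-Reasoning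

  combination≡sgn⇒const : ∀ σ β → combination σ ≡ sgn β → ∀ a → t a ≢ 0ℚ → σ a ≡ β
  combination≡sgn⇒const σ β c≡β a ta≢0 =
    xor-not≡true⇒≡ (combination≡-1⇒true (λ b → σ b xor not β) c′≡-1 a ta≢0)
    where
    c′≡-1 : combination (λ b → σ b xor not β) ≡ - 1ℚ
    c′≡-1 = trans (combination-xor σ (not β)) (trans (cong (_* sgn (not β)) c≡β) (sgn-*-not β))

module IntegerPoint (m : ℕ) (v : F2 m → ℤ) (t : F2 m → ℚ)
  (t≥0 : ∀ a → 0ℚ ≤ t a) (Σt≡1 : ΣF2 m t ≡ 1ℚ)
  (v≡Σth : ∀ x → toℚ (v x) ≡ ΣF2 m (λ a → t a * h a x)) where

  open SignCombination t t≥0 Σt≡1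

  ConstantOnT : F2 m → Bool → Set
  ConstantOnT x β = ∀ a → Tset t a → dot x a ≡ β

  supp⇒constant : ∀ {x} → supp v x → ∃ (ConstantOnT x)
  supp⇒constant {x} vx≢0 =
    let β , vx≡β = integer-in-[-1,1] (v x) (subst (- 1ℚ ≤_) (sym (v≡Σth x)) (-1≤combination (dot x)))
                                            (subst (_≤ 1ℚ) (sym (v≡Σth x)) (combination≤1 (dot x))) vx≢0
    in β , combination≡sgn⇒const (dot x) β (trans (sym (v≡Σth x)) vx≡β)

  constant⇒supp : ∀ {x β} → ConstantOnT x β → supp v x
  constant⇒supp {x} {β} const vx≡0 =
    sgn≢0 β (trans (sym (combination-const const)) (trans (sym (v≡Σth x)) (cong toℚ vx≡0)))

  supp-isSubspace : IsSubspace m (supp v)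
  supp-isSubspace = constant⇒supp (λ a _ → dot-𝟘ˡ a) , closed
    where
    closed : ∀ x y → supp v x → supp v y → supp v (x ⊕ y)
    closed x y vx≢0 vy≢0 =
      let _ , x-const = supp⇒constant vx≢0
          _ , y-const = supp⇒constant vy≢0
      in constant⇒supp (λ a ta≢0 → trans (dot-⊕ˡ x y a) (cong₂ _xor_ (x-const a ta≢0) (y-const a ta≢0)))

  t*cardF2 : ∀ a → t a * cardF2 m ≡ ΣF2 m (λ x → toℚ (v x) * h a x)
  t*cardF2 a = trans (sym (hadamard-inversion m t a))
    (sumℚ-map-cong (λ x → cong (_* h a x) (sym (v≡Σth x))) (allVecs m))

  t-invariant : ∀ {c} → Perp m (supp v) c → ∀ a → t (c ⊕ a) ≡ t a
  t-invariant {c} c⊥ a = *-cancelʳ-≡-pos (cardF2 m) (cardF2-pos m) (begin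
    t (c ⊕ a) * cardF2 m                      ≡⟨ t*cardF2 (c ⊕ a) ⟩
    ΣF2 m (λ x → toℚ (v x) * h (c ⊕ a) x)     ≡⟨ sumℚ-map-cong translate (allVecs m) ⟩
    ΣF2 m (λ x → toℚ (v x) * h a x)           ≡⟨ sym (t*cardF2 a) ⟩
    t a * cardF2 m                            ∎)
    where
    open ≡-Reasoning
    translate : ∀ x → toℚ (v x) * h (c ⊕ a) x ≡ toℚ (v x) * h a x
    translate x with v x ℤ.≟ pos 0
    ... | yes vx≡0 rewrite vx≡0 = trans (*-zeroˡ (h (c ⊕ a) x)) (sym (*-zeroˡ (h a x)))
    ... | no  vx≢0 = cong (λ β → toℚ (v x) * sgn β) (dot-⊕-perp c⊥ vx≢0 a)

  T-nonempty : ∃ (Tset t)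
  T-nonempty = sumℚ-map-≢0 t (allVecs m) (λ Σt≡0 → sgn≢0 false (trans (sym Σt≡1) Σt≡0))

  b : F2 m
  b = proj₁ T-nonempty

  b∈T : Tset t b
  b∈T = proj₂ T-nonempty

  InCoset : F2 m → Set
  InCoset a = Σ[ c ∈ F2 m ] (Perp m (supp v) c × a ≡ c ⊕ b)

  T⇒coset : ∀ a → Tset t a → InCoset a
  T⇒coset a ta≢0 = a ⊕ b , a⊕b⊥supp , sym (⊕-cancelʳ a b)
    where
    a⊕b⊥supp : Perp m (supp v) (a ⊕ b)
    a⊕b⊥supp x vx≢0 = let β , x-const = supp⇒constant vx≢0 in
      trans (dot-⊕ʳ x a b) (trans (cong₂ _xor_ (x-const a ta≢0) (x-const b b∈T)) (xor-same β))

  t-coset : ∀ a → InCoset a → t a ≡ t b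
  t-coset _ (c , c⊥ , refl) = t-invariant c⊥ b

  coset⇒T : ∀ a → InCoset a → Tset t a
  coset⇒T a a∈coset ta≡0 = b∈T (trans (sym (t-coset a a∈coset)) ta≡0)

  t-uniform : ∀ a → Tset t a → t a ≡ t b
  t-uniform a ta≢0 = t-coset a (T⇒coset a ta≢0)

  t-b*cardT≡1 : t b * cardT m t ≡ 1ℚ
  t-b*cardT≡1 = begin
    t b * cardT m t                              ≡⟨ cong (t b *_) (sym (sumℚ-map-1 (Tlist m t))) ⟩
    t b * sumℚ (map (λ _ → 1ℚ) (Tlist m t))      ≡⟨ sym (sumℚ-map-uniform t (λ _ → 1ℚ) t-uniform (allVecs m)) ⟩
    ΣF2 m (λ a → t a * 1ℚ)                       ≡⟨ sumℚ-map-cong (λ a → *-identityʳ (t a)) (allVecs m) ⟩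
    ΣF2 m t                                      ≡⟨ Σt≡1 ⟩
    1ℚ                                           ∎
    where open ≡-Reasoning

  v≡t-b*sumHT : ∀ x → toℚ (v x) ≡ t b * sumHT m t x
  v≡t-b*sumHT x = trans (v≡Σth x) (sumℚ-map-uniform t (λ c → h c x) t-uniform (allVecs m))

  v-barycentre : ∀ x → toℚ (v x) * cardT m t ≡ sumHT m t x
  v-barycentre x = begin
    toℚ (v x) * cardT m t               ≡⟨ cong (_* cardT m t) (v≡t-b*sumHT x) ⟩
    t b * sumHT m t x * cardT m t       ≡⟨ cong (_* cardT m t) (*-comm (t b) (sumHT m t x)) ⟩
    sumHT m t x * t b * cardT m t       ≡⟨ *-assoc (sumHT m t x) (t b) (cardT m t) ⟩
    sumHT m t x * (t b * cardT m t)     ≡⟨ cong (sumHT m t x *_) t-b*cardT≡1 ⟩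
    sumHT m t x * 1ℚ                    ≡⟨ *-identityʳ (sumHT m t x) ⟩
    sumHT m t x                         ∎
    where open ≡-Reasoning

proposition1 : (m : ℕ) (v : F2 m → ℤ) (t : F2 m → ℚ) → InHadamard m v t →
    IsSubspace m (supp v)
    × (Σ[ b ∈ F2 m ] (∀ a → (Tset t a → Σ[ c ∈ F2 m ] (Perp m (supp v) c × a ≡ c ⊕ b))
                          × (Σ[ c ∈ F2 m ] (Perp m (supp v) c × a ≡ c ⊕ b) → Tset t a)))
    × (∀ x → toℚ (v x) * cardT m t ≡ sumHT m t x)
proposition1 m v t (t≥0 , Σt≡1 , v≡Σth) =
  supp-isSubspace , (b , λ a → T⇒coset a , coset⇒T a) , v-barycentre
  where open IntegerPoint m v t t≥0 Σt≡1 v≡Σth
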